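{- Let $p$ be a prime and $k \ge 3$ an integer, and let $\Gamma = \mathrm{Kn}(kp,p)$ be the Kneser graph. For each vertex $x$ of $\Gamma$ define $\vec x = \sum_{v \in V(\Gamma)} |x \cap v|\, \vec e_v \in \mathbb{Z}^{V(\Gamma)}$. Then $C_\Gamma \vec x \equiv \vec 0 \pmod p$, i.e. $\vec x$ (reduced mod $p$) lies in the right kernel of $C_\Gamma$ over $\mathbb{Z}/p\mathbb{Z}$.
   Context: The Kneser graph $\mathrm{Kn}(n,k)$ has as vertices the $k$-element subsets of $\{1,\dots,n\}$, two vertices being adjacent iff the subsets are disjoint. For a vertex $v$ of a graph, $N[v]$ is its closed neighbourhood ($v$ and its neighbours), and $\vec e_v$ is the standard basis vector indexed by $v$; for a set $S$ of vertices, $\vec S=\sum_{v\in S}\vec e_v$. The RA matrix $C_\Gamma$ is the integer matrix with one column per vertex whose rows are the vectors $\vec{N[v]}$ for all vertices $v$ together with $\overrightarrow{N[u]\cap N[v]}$ for all pairs of vertices $u,v$. -}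

module Defs where

open import Data.Nat using (ℕ; zero; suc; _+_; _*_)
import Data.Nat as ℕ
open import Data.Bool using (Bool; true; false; _∨_)
import Data.Bool as B
open import Data.Vec using (Vec; []; _∷_)
open import Data.Vec.Properties using (≡-dec)
open import Data.Fin.Subset using (Subset; _∩_; ∣_∣; ⊥; inside; outside)
open import Data.Product using (Σ; _,_; proj₁; _×_)
open import Data.Sum using (_⊎_; inj₁; inj₂)
open import Relation.Binary.PropositionalEquality using (_≡_)
open import Relation.Nullary using (yes; no)
open import Relation.Nullary.Decidable using (⌊_⌋)

KnVertex : ℕ → ℕ → Set
KnVertex n k = Σ (Subset n) (λ S → ∣ S ∣ ≡ k)

_≟S_ : ∀ {n} → (S T : Subset n) → Bool
S ≟S T = ⌊ ≡-dec B._≟_ S T ⌋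

adjacent : ∀ {n k} → KnVertex n k → KnVertex n k → Bool
adjacent (S , _) (T , _) = (S ∩ T) ≟S ⊥

inClosedNbhd : ∀ {n k} → (v w : KnVertex n k) → Bool
inClosedNbhd v w = (proj₁ v ≟S proj₁ w) ∨ adjacent v w

sumSubsets : (n : ℕ) → (Subset n → ℕ) → ℕ
sumSubsets zero f = f []
sumSubsets (suc n) f =
  sumSubsets n (λ S → f (inside ∷ S)) + sumSubsets n (λ S → f (outside ∷ S))

sumVertices : (n k : ℕ) → (KnVertex n k → ℕ) → ℕ
sumVertices n k f = sumSubsets n g
  where
  g : Subset n → ℕ
  g S with ℕ._≟_ ∣ S ∣ k
  ... | yes eq = f (S , eq)
  ... | no _ = 0

boolToℕ : Bool → ℕ
boolToℕ true = 1
boolToℕ false = 0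

-- Rows of the RA matrix C_Γ: one row N[v] per vertex v, and one row
-- N[u] ∩ N[v] per (ordered) pair of vertices u, v.
RARow : ℕ → ℕ → Set
RARow n k = KnVertex n k ⊎ (KnVertex n k × KnVertex n k)

RAEntry : ∀ {n k} → RARow n k → KnVertex n k → ℕ
RAEntry (inj₁ v) w = boolToℕ (inClosedNbhd v w)
RAEntry (inj₂ (u , v)) w = boolToℕ (inClosedNbhd u w B.∧ inClosedNbhd v w)

-- (C_Γ y)_r for y ∈ ℤ^{V(Γ)} with nonnegative entries (given as ℕ-valued)
RAApply : (n k : ℕ) → (KnVertex n k → ℕ) → RARow n k → ℕ
RAApply n k y r = sumVertices n k (λ w → RAEntry r w * y w)

vecOf : ∀ {n k} → KnVertex n k → KnVertex n k → ℕ
vecOf (x , _) (v , _) = ∣ x ∩ v ∣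

-- Row r of C_Γ applied to x⃗ is Σ |x ∩ S| over the p-sets S in the support of r. That support
-- consists of the p-sets disjoint from A, where A = U for the row N[U] and A = U ∪ V for the row
-- N[U] ∩ N[V], together with U (and V) when they lie in it. Double counting gives
-- Σ_{|S| = p, S ∩ A = ∅} |x ∩ S| = |x ∖ A| · C(|∁A| − 1, p − 1), and |∁A| − 1 is (k−2)p + (p−1),
-- (k−3)p + (p−1) or (k−2)p + (t−1) with t = |U ∩ V| ∈ (0, p), according as the row is N[U], or
-- N[U] ∩ N[V] with U ≠ V disjoint or meeting. Comparing
-- j! · C(N, j) with the product of the j integers ending at N shows C(ap + j, j) ≡ 1 and
-- C(ap + b, j) ≡ 0 (mod p) for b < j < p. Hence the row sum is ≡ |x ∖ A| + |x ∩ U| (+ |x ∩ V|) = |x| = p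
-- in the first two cases and ≡ 0 in the third.
module Submission where

open import Defs
open import Data.Bool using (Bool; false; _∧_; _∨_)
import Data.Bool as B
open import Data.Bool.Properties using (∧-zeroʳ; ∧-identityʳ; ∧-idem)
open import Data.Empty using (⊥-elim)
open import Data.Fin.Subset using (Subset; _∩_; _∪_; ∁; ∣_∣; ⊥; inside; outside)
open import Data.Fin.Subset.Properties
  using (∩-comm; ∩-idem; ∩-abs-∪; ∩-distribʳ-∪; ∪-comm; ∣⊥∣≡0; ∣p∣≤n; ∣∁p∣≡n∸∣p∣; ∣p∩q∣≤∣p∣; ∣p∩q∣≤∣q∣)
open import Data.Nat using (ℕ; zero; suc; _+_; _*_; _∸_; _≤_; _<_; _≥_; _≤?_; s≤s; s<s⁻¹; _!; nonTrivial⇒≢1)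
import Data.Nat as ℕ
open import Data.Nat.Combinatorics using (_C_; nCk+nC[k+1]≡[n+1]C[k+1])
open import Data.Nat.Combinatorics.Base using (_P′_)
open import Data.Nat.Divisibility
open import Data.Nat.Primality using (Prime; euclidsLemma; prime⇒nonTrivial; ¬prime[0])
open import Data.Nat.Properties
open import Algebra.Properties.CommutativeSemigroup +-commutativeSemigroup
  using () renaming (interchange to +-interchange)
open import Algebra.Properties.CommutativeSemigroup *-commutativeSemigroup using (x∙yz≈y∙xz)
open import Data.Nat.Tactic.RingSolver using (solve-∀)
open import Data.Product using (∃; _,_; proj₁)
open import Data.Sum using (inj₁; inj₂)
open import Data.Vec using ([]; _∷_)
open import Data.Vec.Properties using (≡-dec; ∷-injectiveʳ)
open import Function using (_∘_)
open import Relation.Binary.PropositionalEquality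
open import Relation.Nullary using (¬_; Dec; does; yes; no)
open import Relation.Nullary.Decidable using (dec-true; dec-false; isYes≗does)

-- Sums over subsets

infix 4 _≟ˢ_

-- Unlike the ⌊_⌋ used in Defs, `does` of this decision computes on _∷_; ⌊N⌋≡N bridges the two.
_≟ˢ_ : ∀ {n} (U S : Subset n) → Dec (U ≡ S)
_≟ˢ_ = ≡-dec B._≟_

sumSubsets-cong : ∀ n {f g : Subset n → ℕ} → (∀ S → f S ≡ g S) → sumSubsets n f ≡ sumSubsets n g
sumSubsets-cong zero    f≗g = f≗g []
sumSubsets-cong (suc n) f≗g =
  cong₂ _+_ (sumSubsets-cong n (λ S → f≗g (inside ∷ S))) (sumSubsets-cong n (λ S → f≗g (outside ∷ S)))

sumSubsets-zero : ∀ n {f : Subset n → ℕ} → (∀ S → f S ≡ 0) → sumSubsets n f ≡ 0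
sumSubsets-zero zero    f≗0 = f≗0 []
sumSubsets-zero (suc n) f≗0 =
  cong₂ _+_ (sumSubsets-zero n (λ S → f≗0 (inside ∷ S))) (sumSubsets-zero n (λ S → f≗0 (outside ∷ S)))

sumSubsets-+ : ∀ n (f g : Subset n → ℕ) →
               sumSubsets n (λ S → f S + g S) ≡ sumSubsets n f + sumSubsets n g
sumSubsets-+ zero    f g = refl
sumSubsets-+ (suc n) f g = begin
  sumSubsets n (λ S → f (inside ∷ S) + g (inside ∷ S)) +
  sumSubsets n (λ S → f (outside ∷ S) + g (outside ∷ S)) ≡⟨ cong₂ _+_ (sumSubsets-+ n _ _) (sumSubsets-+ n _ _) ⟩
  (fᵢ + gᵢ) + (fₒ + gₒ)                                   ≡⟨ +-interchange fᵢ gᵢ fₒ gₒ ⟩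
  (fᵢ + fₒ) + (gᵢ + gₒ)                                   ∎
  where
  open ≡-Reasoning
  fᵢ = sumSubsets n (λ S → f (inside ∷ S))
  gᵢ = sumSubsets n (λ S → g (inside ∷ S))
  fₒ = sumSubsets n (λ S → f (outside ∷ S))
  gₒ = sumSubsets n (λ S → g (outside ∷ S))

sumSubsets-δ : ∀ n (U : Subset n) (g : Subset n → ℕ) →
               sumSubsets n (λ S → boolToℕ (does (U ≟ˢ S)) * g S) ≡ g U
sumSubsets-δ zero    []            g = +-identityʳ (g [])
sumSubsets-δ (suc n) (inside ∷ U)  g =
  trans (cong₂ _+_ (sumSubsets-δ n U (λ S → g (inside ∷ S))) (sumSubsets-zero n (λ _ → refl)))
        (+-identityʳ (g (inside ∷ U)))
sumSubsets-δ (suc n) (outside ∷ U) g =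
  cong₂ _+_ (sumSubsets-zero n (λ _ → refl)) (sumSubsets-δ n U (λ S → g (outside ∷ S)))

sumOfSize : ∀ n → ℕ → (Subset n → ℕ) → ℕ
sumOfSize n k f = sumSubsets n (λ S → boolToℕ (does (∣ S ∣ ℕ.≟ k)) * f S)

mutual
  sumVertices≡sumOfSize : ∀ n k (f : Subset n → ℕ) → sumVertices n k (λ v → f (proj₁ v)) ≡ sumOfSize n k f
  sumVertices≡sumOfSize n k f = sumSubsets-cong n (summand n k f)

  -- The left side is the summand of sumVertices, which is local to Defs and cannot be named;
  -- its type is fixed by the use above.
  summand : ∀ n k (f : Subset n → ℕ) (S : Subset n) → _ ≡ boolToℕ (does (∣ S ∣ ℕ.≟ k)) * f S
  summand n k f S with ∣ S ∣ ℕ.≟ k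
  ... | yes ∣S∣≡k =
    sym (trans (cong (λ b → boolToℕ b * f S) (dec-true (∣ S ∣ ℕ.≟ k) ∣S∣≡k)) (+-identityʳ (f S)))
  ... | no ∣S∣≢k  = sym (cong (λ b → boolToℕ b * f S) (dec-false (∣ S ∣ ℕ.≟ k) ∣S∣≢k))

sumOfSize-cong : ∀ n k {f g : Subset n → ℕ} → (∀ S → f S ≡ g S) → sumOfSize n k f ≡ sumOfSize n k g
sumOfSize-cong n k f≗g = sumSubsets-cong n (λ S → cong (boolToℕ (does (∣ S ∣ ℕ.≟ k)) *_) (f≗g S))

sumOfSize-+ : ∀ n k (f g : Subset n → ℕ) →
              sumOfSize n k (λ S → f S + g S) ≡ sumOfSize n k f + sumOfSize n k g
sumOfSize-+ n k f g =
  trans (sumSubsets-cong n (λ S → *-distribˡ-+ (boolToℕ (does (∣ S ∣ ℕ.≟ k))) (f S) (g S)))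
        (sumSubsets-+ n _ _)

sumOfSize-δ : ∀ n {k} {U : Subset n} (g : Subset n → ℕ) → ∣ U ∣ ≡ k →
              sumOfSize n k (λ S → boolToℕ (does (U ≟ˢ S)) * g S) ≡ g U
sumOfSize-δ n {k} {U} g ∣U∣≡k = begin
  sumOfSize n k (λ S → boolToℕ (does (U ≟ˢ S)) * g S)
    ≡⟨ sumSubsets-cong n (λ S → x∙yz≈y∙xz (size S) (boolToℕ (does (U ≟ˢ S))) (g S)) ⟩
  sumSubsets n (λ S → boolToℕ (does (U ≟ˢ S)) * (size S * g S))
    ≡⟨ sumSubsets-δ n U (λ S → size S * g S) ⟩
  size U * g U
    ≡⟨ cong (λ b → boolToℕ b * g U) (dec-true (∣ U ∣ ℕ.≟ k) ∣U∣≡k) ⟩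
  g U + 0
    ≡⟨ +-identityʳ (g U) ⟩
  g U ∎
  where
  open ≡-Reasoning
  size : Subset n → ℕ
  size S = boolToℕ (does (∣ S ∣ ℕ.≟ k))

sumOfSize-disjoint : ∀ n (A : Subset n) j → sumOfSize n j (λ S → boolToℕ (does (A ∩ S ≟ˢ ⊥))) ≡ ∣ ∁ A ∣ C j
sumOfSize-disjoint zero    []            zero    = refl
sumOfSize-disjoint zero    []            (suc j) = refl
sumOfSize-disjoint (suc n) (inside ∷ A)  j       =
  cong₂ _+_ (sumSubsets-zero n (λ S → *-zeroʳ (boolToℕ (does (∣ inside ∷ S ∣ ℕ.≟ j)))))
            (sumOfSize-disjoint n A j)
sumOfSize-disjoint (suc n) (outside ∷ A) zero    =
  cong₂ _+_ (sumSubsets-zero n (λ _ → refl)) (sumOfSize-disjoint n A zero)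
sumOfSize-disjoint (suc n) (outside ∷ A) (suc j) =
  trans (cong₂ _+_ (sumOfSize-disjoint n A j) (sumOfSize-disjoint n A (suc j)))
        (nCk+nC[k+1]≡[n+1]C[k+1] ∣ ∁ A ∣ j)

disjointWeight : ∀ n → Subset n → Subset n → ℕ → ℕ
disjointWeight n A X j = sumOfSize n j (λ S → boolToℕ (does (A ∩ S ≟ˢ ⊥)) * ∣ X ∩ S ∣)

disjointWeight-zero : ∀ n (A X : Subset n) → disjointWeight n A X 0 ≡ 0
disjointWeight-zero n A X = sumSubsets-zero n vanishes
  where
  vanishes : ∀ S → boolToℕ (does (∣ S ∣ ℕ.≟ 0)) * (boolToℕ (does (A ∩ S ≟ˢ ⊥)) * ∣ X ∩ S ∣) ≡ 0
  vanishes S with ∣ S ∣ | ∣p∩q∣≤∣q∣ X S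
  ... | suc _ | _       = refl
  ... | zero  | ∣X∩S∣≤0 rewrite n≤0⇒n≡0 ∣X∩S∣≤0 =
    trans (+-identityʳ _) (*-zeroʳ (boolToℕ (does (A ∩ S ≟ˢ ⊥))))

-- When m = 0 the truncated m ∸ 1 is harmless because c vanishes.
c*[m∸1]Ck+c*[m∸1]C[1+k]≡c*mC[1+k] : ∀ c m k → (m ≡ 0 → c ≡ 0) →
                                    c * ((m ∸ 1) C k) + c * ((m ∸ 1) C suc k) ≡ c * (m C suc k)
c*[m∸1]Ck+c*[m∸1]C[1+k]≡c*mC[1+k] c zero    k c≡0 rewrite c≡0 refl = refl
c*[m∸1]Ck+c*[m∸1]C[1+k]≡c*mC[1+k] c (suc m) k _ =
  trans (sym (*-distribˡ-+ c (m C k) (m C suc k))) (cong (c *_) (nCk+nC[k+1]≡[n+1]C[k+1] m k))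

mutual
  disjointWeight-suc : ∀ n (A X : Subset n) j →
                       disjointWeight n A X (suc j) ≡ ∣ X ∩ ∁ A ∣ * ((∣ ∁ A ∣ ∸ 1) C j)
  disjointWeight-suc zero    []            []            j = refl
  disjointWeight-suc (suc n) (inside ∷ A)  (inside ∷ X)  j =
    cong₂ _+_ (sumSubsets-zero n (λ S → *-zeroʳ (boolToℕ (does (∣ S ∣ ℕ.≟ j))))) (disjointWeight-suc n A X j)
  disjointWeight-suc (suc n) (inside ∷ A)  (outside ∷ X) j =
    cong₂ _+_ (sumSubsets-zero n (λ S → *-zeroʳ (boolToℕ (does (∣ S ∣ ℕ.≟ j))))) (disjointWeight-suc n A X j)
  disjointWeight-suc (suc n) (outside ∷ A) (outside ∷ X) j = disjointWeight-consecutive n A X j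
  disjointWeight-suc (suc n) (outside ∷ A) (inside ∷ X)  j = begin
    sumOfSize n j (λ S → disjoint S * suc ∣ X ∩ S ∣) + disjointWeight n A X (suc j)
      ≡⟨ cong (_+ disjointWeight n A X (suc j))
              (trans (sumOfSize-cong n j (λ S → *-suc (disjoint S) ∣ X ∩ S ∣)) (sumOfSize-+ n j _ _)) ⟩
    (sumOfSize n j disjoint + disjointWeight n A X j) + disjointWeight n A X (suc j)
      ≡⟨ +-assoc (sumOfSize n j disjoint) (disjointWeight n A X j) (disjointWeight n A X (suc j)) ⟩
    sumOfSize n j disjoint + (disjointWeight n A X j + disjointWeight n A X (suc j))
      ≡⟨ cong₂ _+_ (sumOfSize-disjoint n A j) (disjointWeight-consecutive n A X j) ⟩
    ∣ ∁ A ∣ C j + ∣ X ∩ ∁ A ∣ * (∣ ∁ A ∣ C j) ∎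
    where
    open ≡-Reasoning
    disjoint : Subset n → ℕ
    disjoint S = boolToℕ (does (A ∩ S ≟ˢ ⊥))

  disjointWeight-consecutive : ∀ n (A X : Subset n) j →
    disjointWeight n A X j + disjointWeight n A X (suc j) ≡ ∣ X ∩ ∁ A ∣ * (∣ ∁ A ∣ C j)
  disjointWeight-consecutive n A X zero    =
    cong₂ _+_ (disjointWeight-zero n A X) (disjointWeight-suc n A X zero)
  disjointWeight-consecutive n A X (suc j) =
    trans (cong₂ _+_ (disjointWeight-suc n A X j) (disjointWeight-suc n A X (suc j)))
          (c*[m∸1]Ck+c*[m∸1]C[1+k]≡c*mC[1+k] (∣ X ∩ ∁ A ∣) (∣ ∁ A ∣) j
            (λ ∣∁A∣≡0 → n≤0⇒n≡0 (subst (∣ X ∩ ∁ A ∣ ≤_) ∣∁A∣≡0 (∣p∩q∣≤∣q∣ X (∁ A)))))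

-- Closed neighbourhoods

N[_] : ∀ {n} → Subset n → Subset n → Bool
N[ U ] S = does (U ≟ˢ S) ∨ does (U ∩ S ≟ˢ ⊥)

⌊N⌋≡N : ∀ {n} (U S : Subset n) → (U ≟S S) ∨ ((U ∩ S) ≟S ⊥) ≡ N[ U ] S
⌊N⌋≡N U S = cong₂ _∨_ (isYes≗does (U ≟ˢ S)) (isYes≗does (U ∩ S ≟ˢ ⊥))

∪-≟⊥ : ∀ {n} (P Q : Subset n) → does (P ∪ Q ≟ˢ ⊥) ≡ does (P ≟ˢ ⊥) ∧ does (Q ≟ˢ ⊥)
∪-≟⊥ []            []            = refl
∪-≟⊥ (inside ∷ P)  (_ ∷ Q)       = refl
∪-≟⊥ (outside ∷ P) (inside ∷ Q)  = sym (∧-zeroʳ (does (P ≟ˢ ⊥)))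
∪-≟⊥ (outside ∷ P) (outside ∷ Q) = ∪-≟⊥ P Q

∩-≟⊥-false : ∀ {n} {U W : Subset n} → U ∩ W ≡ W → W ≢ ⊥ → does (U ∩ W ≟ˢ ⊥) ≡ false
∩-≟⊥-false U∩W≡W W≢⊥ = dec-false (_ ≟ˢ ⊥) (W≢⊥ ∘ trans (sym U∩W≡W))

∣p∣≡1+k⇒p≢⊥ : ∀ {n k} {P : Subset n} → ∣ P ∣ ≡ suc k → P ≢ ⊥
∣p∣≡1+k⇒p≢⊥ {n} ∣P∣≡1+k refl = 0≢1+n (trans (sym (∣⊥∣≡0 n)) ∣P∣≡1+k)

N-split : ∀ {n} {U : Subset n} → U ≢ ⊥ → ∀ S →
          boolToℕ (N[ U ] S) ≡ boolToℕ (does (U ∩ S ≟ˢ ⊥)) + boolToℕ (does (U ≟ˢ S))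
N-split {U = U} U≢⊥ S with U ≟ˢ S
... | yes refl rewrite ∩-≟⊥-false (∩-idem U) U≢⊥ = refl
... | no _     = sym (+-identityʳ _)

N∧N-split : ∀ {n} {U V : Subset n} → U ≢ ⊥ → V ≢ ⊥ → U ≢ V → ∀ S →
            boolToℕ (N[ U ] S ∧ N[ V ] S) ≡
            boolToℕ (does ((U ∪ V) ∩ S ≟ˢ ⊥)) +
            boolToℕ (does (U ∩ V ≟ˢ ⊥)) * (boolToℕ (does (U ≟ˢ S)) + boolToℕ (does (V ≟ˢ S)))
N∧N-split {U = U} {V} U≢⊥ V≢⊥ U≢V S with U ≟ˢ S | V ≟ˢ S
... | yes refl | yes refl = ⊥-elim (U≢V refl)
... | yes refl | no _
  rewrite ∩-≟⊥-false (trans (∩-comm (U ∪ V) U) (∩-abs-∪ U V)) U≢⊥ | ∩-comm V U =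
  sym (*-identityʳ _)
... | no _     | yes refl
  rewrite ∩-≟⊥-false (trans (∩-comm (U ∪ V) V) (trans (cong (V ∩_) (∪-comm U V)) (∩-abs-∪ V U))) V≢⊥
        | ∧-identityʳ (does (U ∩ V ≟ˢ ⊥)) =
  sym (*-identityʳ _)
... | no _     | no _
  rewrite ∩-distribʳ-∪ S U V | ∪-≟⊥ (U ∩ S) (V ∩ S) =
  sym (trans (cong (boolToℕ (does (U ∩ S ≟ˢ ⊥) ∧ does (V ∩ S ≟ˢ ⊥)) +_)
                   (*-zeroʳ (boolToℕ (does (U ∩ V ≟ˢ ⊥)))))
             (+-identityʳ _))

sumOfSize-N : ∀ n {j} (X : Subset n) {U : Subset n} → ∣ U ∣ ≡ suc j →
              sumOfSize n (suc j) (λ S → boolToℕ (N[ U ] S) * ∣ X ∩ S ∣) ≡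
              ∣ X ∩ ∁ U ∣ * ((∣ ∁ U ∣ ∸ 1) C j) + ∣ X ∩ U ∣
sumOfSize-N n {j} X {U} ∣U∣≡1+j = begin
  sumOfSize n (suc j) (λ S → boolToℕ (N[ U ] S) * ∣ X ∩ S ∣)
    ≡⟨ sumOfSize-cong n (suc j) (λ S → trans (cong (_* ∣ X ∩ S ∣) (N-split {U = U} U≢⊥ S))
                                             (*-distribʳ-+ ∣ X ∩ S ∣ (disjoint S) (δ S))) ⟩
  sumOfSize n (suc j) (λ S → disjoint S * ∣ X ∩ S ∣ + δ S * ∣ X ∩ S ∣)
    ≡⟨ sumOfSize-+ n (suc j) _ _ ⟩
  disjointWeight n U X (suc j) + sumOfSize n (suc j) (λ S → δ S * ∣ X ∩ S ∣)
    ≡⟨ cong₂ _+_ (disjointWeight-suc n U X j) (sumOfSize-δ n {U = U} (λ S → ∣ X ∩ S ∣) ∣U∣≡1+j) ⟩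
  ∣ X ∩ ∁ U ∣ * ((∣ ∁ U ∣ ∸ 1) C j) + ∣ X ∩ U ∣ ∎
  where
  open ≡-Reasoning
  U≢⊥ = ∣p∣≡1+k⇒p≢⊥ ∣U∣≡1+j
  disjoint δ : Subset n → ℕ
  disjoint S = boolToℕ (does (U ∩ S ≟ˢ ⊥))
  δ S = boolToℕ (does (U ≟ˢ S))

sumOfSize-N∧N : ∀ n {j} (X : Subset n) {U V : Subset n} → ∣ U ∣ ≡ suc j → ∣ V ∣ ≡ suc j → U ≢ V →
                sumOfSize n (suc j) (λ S → boolToℕ (N[ U ] S ∧ N[ V ] S) * ∣ X ∩ S ∣) ≡
                ∣ X ∩ ∁ (U ∪ V) ∣ * ((∣ ∁ (U ∪ V) ∣ ∸ 1) C j) +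
                boolToℕ (does (U ∩ V ≟ˢ ⊥)) * (∣ X ∩ U ∣ + ∣ X ∩ V ∣)
sumOfSize-N∧N n {j} X {U} {V} ∣U∣≡1+j ∣V∣≡1+j U≢V = begin
  sumOfSize n (suc j) (λ S → boolToℕ (N[ U ] S ∧ N[ V ] S) * ∣ X ∩ S ∣)
    ≡⟨ sumOfSize-cong n (suc j) (λ S → trans (cong (_* ∣ X ∩ S ∣) (N∧N-split {U = U} {V} U≢⊥ V≢⊥ U≢V S))
                                             (distribute (disjoint S) d (δ U S) (δ V S) ∣ X ∩ S ∣)) ⟩
  sumOfSize n (suc j) (λ S → disjoint S * ∣ X ∩ S ∣ + (δ U S * (d * ∣ X ∩ S ∣) + δ V S * (d * ∣ X ∩ S ∣)))
    ≡⟨ trans (sumOfSize-+ n (suc j) _ _) (cong (disjointWeight n (U ∪ V) X (suc j) +_) (sumOfSize-+ n (suc j) _ _)) ⟩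
  disjointWeight n (U ∪ V) X (suc j) +
  (sumOfSize n (suc j) (λ S → δ U S * (d * ∣ X ∩ S ∣)) + sumOfSize n (suc j) (λ S → δ V S * (d * ∣ X ∩ S ∣)))
    ≡⟨ cong₂ _+_ (disjointWeight-suc n (U ∪ V) X j)
                 (cong₂ _+_ (sumOfSize-δ n {U = U} (λ S → d * ∣ X ∩ S ∣) ∣U∣≡1+j)
                            (sumOfSize-δ n {U = V} (λ S → d * ∣ X ∩ S ∣) ∣V∣≡1+j)) ⟩
  c * binom + (d * ∣ X ∩ U ∣ + d * ∣ X ∩ V ∣)
    ≡⟨ cong (c * binom +_) (sym (*-distribˡ-+ d (∣ X ∩ U ∣) (∣ X ∩ V ∣))) ⟩
  c * binom + d * (∣ X ∩ U ∣ + ∣ X ∩ V ∣) ∎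
  where
  open ≡-Reasoning
  U≢⊥ = ∣p∣≡1+k⇒p≢⊥ ∣U∣≡1+j
  V≢⊥ = ∣p∣≡1+k⇒p≢⊥ ∣V∣≡1+j
  c binom d : ℕ
  c     = ∣ X ∩ ∁ (U ∪ V) ∣
  binom = (∣ ∁ (U ∪ V) ∣ ∸ 1) C j
  d = boolToℕ (does (U ∩ V ≟ˢ ⊥))
  disjoint : Subset n → ℕ
  disjoint S = boolToℕ (does ((U ∪ V) ∩ S ≟ˢ ⊥))
  δ : Subset n → Subset n → ℕ
  δ W S = boolToℕ (does (W ≟ˢ S))
  distribute : ∀ a d u v y → (a + d * (u + v)) * y ≡ a * y + (u * (d * y) + v * (d * y))
  distribute = solve-∀

-- Binomial coefficients modulo a prime

n∸i∣nP′k : ∀ n {i k} → i < k → n ∸ i ∣ n P′ k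
n∸i∣nP′k n {i} {suc k} i<1+k with m<1+n⇒m<n∨m≡n i<1+k
... | inj₁ i<k  = ∣n⇒∣m*n (n ∸ k) (n∸i∣nP′k n i<k)
... | inj₂ refl = ∣m⇒∣m*n (n P′ k) ∣-refl

nP′k≡0 : ∀ {n k} → n < k → n P′ k ≡ 0
nP′k≡0 {n} {k} n<k = 0∣⇒≡0 (subst (_∣ n P′ k) (n∸n≡0 n) (n∸i∣nP′k n n<k))

[1+n]P′[1+k]≡[1+n]*nP′k : ∀ n k → suc n P′ suc k ≡ suc n * (n P′ k)
[1+n]P′[1+k]≡[1+n]*nP′k n zero    = refl
[1+n]P′[1+k]≡[1+n]*nP′k n (suc k) = begin
  (n ∸ k) * (suc n P′ suc k)   ≡⟨ cong ((n ∸ k) *_) ([1+n]P′[1+k]≡[1+n]*nP′k n k) ⟩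
  (n ∸ k) * (suc n * (n P′ k)) ≡⟨ x∙yz≈y∙xz (n ∸ k) (suc n) (n P′ k) ⟩
  suc n * ((n ∸ k) * (n P′ k)) ∎
  where open ≡-Reasoning

[1+k]*nP′k+nP′[1+k]≡[1+n]*nP′k : ∀ n k → suc k * (n P′ k) + n P′ suc k ≡ suc n * (n P′ k)
[1+k]*nP′k+nP′[1+k]≡[1+n]*nP′k n k with k ≤? n
... | yes k≤n = begin
  suc k * (n P′ k) + (n ∸ k) * (n P′ k) ≡⟨ sym (*-distribʳ-+ (n P′ k) (suc k) (n ∸ k)) ⟩
  suc (k + (n ∸ k)) * (n P′ k)          ≡⟨ cong (λ m → suc m * (n P′ k)) (m+[n∸m]≡n k≤n) ⟩
  suc n * (n P′ k)                      ∎
  where open ≡-Reasoning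
... | no k≰n rewrite nP′k≡0 (≰⇒> k≰n) =
  trans (cong₂ _+_ (*-zeroʳ (suc k)) (*-zeroʳ (n ∸ k))) (sym (*-zeroʳ (suc n)))

k!*nCk≡nP′k : ∀ n k → k ! * (n C k) ≡ n P′ k
k!*nCk≡nP′k n       zero    = refl
k!*nCk≡nP′k zero    (suc k) = trans (*-zeroʳ (suc k !)) (cong (_* (0 P′ k)) (sym (0∸n≡0 k)))
k!*nCk≡nP′k (suc n) (suc k) = begin
  suc k ! * (suc n C suc k)
    ≡⟨ cong (suc k ! *_) (sym (nCk+nC[k+1]≡[n+1]C[k+1] n k)) ⟩
  suc k ! * (n C k + n C suc k)
    ≡⟨ *-distribˡ-+ (suc k !) (n C k) (n C suc k) ⟩
  suc k ! * (n C k) + suc k ! * (n C suc k)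
    ≡⟨ cong (_+ suc k ! * (n C suc k)) (*-assoc (suc k) (k !) (n C k)) ⟩
  suc k * (k ! * (n C k)) + suc k ! * (n C suc k)
    ≡⟨ cong₂ _+_ (cong (suc k *_) (k!*nCk≡nP′k n k)) (k!*nCk≡nP′k n (suc k)) ⟩
  suc k * (n P′ k) + n P′ suc k
    ≡⟨ [1+k]*nP′k+nP′[1+k]≡[1+n]*nP′k n k ⟩
  suc n * (n P′ k)
    ≡⟨ sym ([1+n]P′[1+k]≡[1+n]*nP′k n k) ⟩
  suc n P′ suc k ∎
  where open ≡-Reasoning

[a*p+k]P′k≡k!+t*p : ∀ a p k → ∃ λ t → (a * p + k) P′ k ≡ k ! + t * p
[a*p+k]P′k≡k!+t*p a p zero    = 0 , refl
[a*p+k]P′k≡k!+t*p a p (suc k) with [a*p+k]P′k≡k!+t*p a p k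
... | t , eq = a * k ! + suc (a * p + k) * t , (begin
  (a * p + suc k) P′ suc k             ≡⟨ cong (_P′ suc k) (+-suc (a * p) k) ⟩
  suc (a * p + k) P′ suc k             ≡⟨ [1+n]P′[1+k]≡[1+n]*nP′k (a * p + k) k ⟩
  suc (a * p + k) * ((a * p + k) P′ k) ≡⟨ cong (suc (a * p + k) *_) eq ⟩
  suc (a * p + k) * (k ! + t * p)      ≡⟨ regroup a p k (k !) t ⟩
  suc k ! + (a * k ! + suc (a * p + k) * t) * p ∎)
  where
  open ≡-Reasoning
  regroup : ∀ a p k f t → suc (a * p + k) * (f + t * p) ≡ suc k * f + (a * f + suc (a * p + k) * t) * p
  regroup = solve-∀

p∤k! : ∀ {p k} → Prime p → k < p → ¬ p ∣ k !
p∤k! {k = zero}  p-prime _   p∣1  = nonTrivial⇒≢1 {{prime⇒nonTrivial p-prime}} (∣1⇒≡1 p∣1)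
p∤k! {k = suc k} p-prime k<p p∣k! with euclidsLemma (suc k) (k !) p-prime p∣k!
... | inj₁ p∣1+k = <⇒≱ k<p (∣⇒≤ p∣1+k)
... | inj₂ p∣k!′ = p∤k! p-prime (<-trans (n<1+n k) k<p) p∣k!′

[a*p+k]Ck≡1+t*p : ∀ {p} a {k} → Prime p → k < p → ∃ λ t → (a * p + k) C k ≡ 1 + t * p
[a*p+k]Ck≡1+t*p {p} a {k} p-prime k<p
  with (a * p + k) C k | k!*nCk≡nP′k (a * p + k) k | [a*p+k]P′k≡k!+t*p a p k
... | zero  | k!*0≡P | t , P≡ =
  ⊥-elim (<⇒≢ (1≤n! k) (sym (m+n≡0⇒m≡0 (k !) (sym (trans (sym (*-zeroʳ (k !))) (trans k!*0≡P P≡))))))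
... | suc c | k!*C≡P | t , P≡
  with euclidsLemma (k !) c p-prime
         (divides t (+-cancelˡ-≡ (k !) _ _ (trans (sym (*-suc (k !) c)) (trans k!*C≡P P≡))))
...   | inj₁ p∣k!              = ⊥-elim (p∤k! p-prime k<p p∣k!)
...   | inj₂ (divides s c≡s*p) = s , cong suc c≡s*p

p∣[a*p+b]Ck : ∀ {p} a {b k} → Prime p → b < k → k < p → p ∣ (a * p + b) C k
p∣[a*p+b]Ck {p} a {b} {k} p-prime b<k k<p with euclidsLemma (k !) ((a * p + b) C k) p-prime p∣k!*C
  where
  p∣k!*C : p ∣ k ! * ((a * p + b) C k)
  p∣k!*C = subst (p ∣_) (sym (k!*nCk≡nP′k (a * p + b) k))
             (∣-trans (n∣m*n a) (subst (_∣ (a * p + b) P′ k) (m+n∸n≡m (a * p) b) (n∸i∣nP′k (a * p + b) b<k)))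
... | inj₁ p∣k! = ⊥-elim (p∤k! p-prime k<p p∣k!)
... | inj₂ p∣C  = p∣C

p∣c*[1+t*p]+r : ∀ {p} c t r → c + r ≡ p → p ∣ c * (1 + t * p) + r
p∣c*[1+t*p]+r c t r refl = divides (1 + c * t) (regroup c t r)
  where
  regroup : ∀ c t r → c * (1 + t * (c + r)) + r ≡ (1 + c * t) * (c + r)
  regroup = solve-∀

-- Cardinalities

∣∁p∣+∣p∣≡n : ∀ {n} (P : Subset n) → ∣ ∁ P ∣ + ∣ P ∣ ≡ n
∣∁p∣+∣p∣≡n P = trans (cong (_+ ∣ P ∣) (∣∁p∣≡n∸∣p∣ P)) (m∸n+n≡m (∣p∣≤n P))

∣p∩q∣+∣p∩∁q∣≡∣p∣ : ∀ {n} (P Q : Subset n) → ∣ P ∩ Q ∣ + ∣ P ∩ ∁ Q ∣ ≡ ∣ P ∣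
∣p∩q∣+∣p∩∁q∣≡∣p∣ []            []            = refl
∣p∩q∣+∣p∩∁q∣≡∣p∣ (outside ∷ P) (_ ∷ Q)       = ∣p∩q∣+∣p∩∁q∣≡∣p∣ P Q
∣p∩q∣+∣p∩∁q∣≡∣p∣ (inside ∷ P)  (inside ∷ Q)  = cong suc (∣p∩q∣+∣p∩∁q∣≡∣p∣ P Q)
∣p∩q∣+∣p∩∁q∣≡∣p∣ (inside ∷ P)  (outside ∷ Q) = trans (+-suc _ _) (cong suc (∣p∩q∣+∣p∩∁q∣≡∣p∣ P Q))

∣p∪q∣+∣p∩q∣≡∣p∣+∣q∣ : ∀ {n} (P Q : Subset n) → ∣ P ∪ Q ∣ + ∣ P ∩ Q ∣ ≡ ∣ P ∣ + ∣ Q ∣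
∣p∪q∣+∣p∩q∣≡∣p∣+∣q∣ []            []            = refl
∣p∪q∣+∣p∩q∣≡∣p∣+∣q∣ (inside ∷ P)  (inside ∷ Q)  =
  cong suc (trans (+-suc _ _) (trans (cong suc (∣p∪q∣+∣p∩q∣≡∣p∣+∣q∣ P Q)) (sym (+-suc _ _))))
∣p∪q∣+∣p∩q∣≡∣p∣+∣q∣ (inside ∷ P)  (outside ∷ Q) = cong suc (∣p∪q∣+∣p∩q∣≡∣p∣+∣q∣ P Q)
∣p∪q∣+∣p∩q∣≡∣p∣+∣q∣ (outside ∷ P) (inside ∷ Q)  =
  trans (cong suc (∣p∪q∣+∣p∩q∣≡∣p∣+∣q∣ P Q)) (sym (+-suc _ _))
∣p∪q∣+∣p∩q∣≡∣p∣+∣q∣ (outside ∷ P) (outside ∷ Q) = ∣p∪q∣+∣p∩q∣≡∣p∣+∣q∣ P Q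

∣p∩[q∪r]∣≡∣p∩q∣+∣p∩r∣ : ∀ {n} (P Q R : Subset n) → Q ∩ R ≡ ⊥ → ∣ P ∩ (Q ∪ R) ∣ ≡ ∣ P ∩ Q ∣ + ∣ P ∩ R ∣
∣p∩[q∪r]∣≡∣p∩q∣+∣p∩r∣ []            []            []            _  = refl
∣p∩[q∪r]∣≡∣p∩q∣+∣p∩r∣ (_ ∷ P)       (inside ∷ Q)  (inside ∷ R)  ()
∣p∩[q∪r]∣≡∣p∩q∣+∣p∩r∣ (outside ∷ P) (inside ∷ Q)  (outside ∷ R) eq =
  ∣p∩[q∪r]∣≡∣p∩q∣+∣p∩r∣ P Q R (∷-injectiveʳ eq)
∣p∩[q∪r]∣≡∣p∩q∣+∣p∩r∣ (outside ∷ P) (outside ∷ Q) (_ ∷ R)       eq =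
  ∣p∩[q∪r]∣≡∣p∩q∣+∣p∩r∣ P Q R (∷-injectiveʳ eq)
∣p∩[q∪r]∣≡∣p∩q∣+∣p∩r∣ (inside ∷ P)  (inside ∷ Q)  (outside ∷ R) eq =
  cong suc (∣p∩[q∪r]∣≡∣p∩q∣+∣p∩r∣ P Q R (∷-injectiveʳ eq))
∣p∩[q∪r]∣≡∣p∩q∣+∣p∩r∣ (inside ∷ P)  (outside ∷ Q) (inside ∷ R)  eq =
  trans (cong suc (∣p∩[q∪r]∣≡∣p∩q∣+∣p∩r∣ P Q R (∷-injectiveʳ eq))) (sym (+-suc _ _))
∣p∩[q∪r]∣≡∣p∩q∣+∣p∩r∣ (inside ∷ P)  (outside ∷ Q) (outside ∷ R) eq =
  ∣p∩[q∪r]∣≡∣p∩q∣+∣p∩r∣ P Q R (∷-injectiveʳ eq)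

∣p∣≡0⇒p≡⊥ : ∀ {n} {P : Subset n} → ∣ P ∣ ≡ 0 → P ≡ ⊥
∣p∣≡0⇒p≡⊥ {P = []}          _     = refl
∣p∣≡0⇒p≡⊥ {P = outside ∷ P} ∣P∣≡0 = cong (outside ∷_) (∣p∣≡0⇒p≡⊥ ∣P∣≡0)

∣p∩q∣≡∣p∣⇒∣p∩∁q∣≡0 : ∀ {n} (P Q : Subset n) → ∣ P ∩ Q ∣ ≡ ∣ P ∣ → ∣ P ∩ ∁ Q ∣ ≡ 0
∣p∩q∣≡∣p∣⇒∣p∩∁q∣≡0 P Q ∣P∩Q∣≡∣P∣ =
  +-cancelˡ-≡ (∣ P ∩ Q ∣) _ 0 (trans (∣p∩q∣+∣p∩∁q∣≡∣p∣ P Q) (trans (sym ∣P∩Q∣≡∣P∣) (sym (+-identityʳ _))))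

∣p∩∁q∣≡0⇒∣q∩∁p∣≡0⇒p≡q : ∀ {n} (P Q : Subset n) → ∣ P ∩ ∁ Q ∣ ≡ 0 → ∣ Q ∩ ∁ P ∣ ≡ 0 → P ≡ Q
∣p∩∁q∣≡0⇒∣q∩∁p∣≡0⇒p≡q []            []            _ _  = refl
∣p∩∁q∣≡0⇒∣q∩∁p∣≡0⇒p≡q (inside ∷ P)  (inside ∷ Q)  e e′ = cong (inside ∷_) (∣p∩∁q∣≡0⇒∣q∩∁p∣≡0⇒p≡q P Q e e′)
∣p∩∁q∣≡0⇒∣q∩∁p∣≡0⇒p≡q (outside ∷ P) (outside ∷ Q) e e′ = cong (outside ∷_) (∣p∩∁q∣≡0⇒∣q∩∁p∣≡0⇒p≡q P Q e e′)

∣p∩q∣≡∣p∣⇒∣p∩q∣≡∣q∣⇒p≡q : ∀ {n} (P Q : Subset n) → ∣ P ∩ Q ∣ ≡ ∣ P ∣ → ∣ P ∩ Q ∣ ≡ ∣ Q ∣ → P ≡ Q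
∣p∩q∣≡∣p∣⇒∣p∩q∣≡∣q∣⇒p≡q P Q ∣P∩Q∣≡∣P∣ ∣P∩Q∣≡∣Q∣ =
  ∣p∩∁q∣≡0⇒∣q∩∁p∣≡0⇒p≡q P Q (∣p∩q∣≡∣p∣⇒∣p∩∁q∣≡0 P Q ∣P∩Q∣≡∣P∣)
    (∣p∩q∣≡∣p∣⇒∣p∩∁q∣≡0 Q P (trans (cong ∣_∣ (∩-comm Q P)) ∣P∩Q∣≡∣Q∣))

-- Rows of the RA matrix

rowSet : ∀ {n k} → RARow n k → Subset n → Bool
rowSet (inj₁ (U , _))             = N[ U ]
rowSet (inj₂ ((U , _) , (V , _))) S = N[ U ] S ∧ N[ V ] S

RAApply≡sumOfSize : ∀ n k (x : KnVertex n k) r →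
                    RAApply n k (vecOf x) r ≡ sumOfSize n k (λ S → boolToℕ (rowSet r S) * ∣ proj₁ x ∩ S ∣)
RAApply≡sumOfSize n k (X , _) (inj₁ (U , _)) =
  trans (sumVertices≡sumOfSize n k (λ S → boolToℕ ((U ≟S S) ∨ ((U ∩ S) ≟S ⊥)) * ∣ X ∩ S ∣))
        (sumOfSize-cong n k (λ S → cong (λ b → boolToℕ b * ∣ X ∩ S ∣) (⌊N⌋≡N U S)))
RAApply≡sumOfSize n k (X , _) (inj₂ ((U , _) , (V , _))) =
  trans (sumVertices≡sumOfSize n k
          (λ S → boolToℕ (((U ≟S S) ∨ ((U ∩ S) ≟S ⊥)) ∧ ((V ≟S S) ∨ ((V ∩ S) ≟S ⊥))) * ∣ X ∩ S ∣))
        (sumOfSize-cong n k (λ S → cong (λ b → boolToℕ b * ∣ X ∩ S ∣) (cong₂ _∧_ (⌊N⌋≡N U S) (⌊N⌋≡N V S))))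

module Kneser (q k : ℕ) (p-prime : Prime (suc q))
              (X : Subset (suc (suc (suc k)) * suc q)) (∣X∣≡p : ∣ X ∣ ≡ suc q) where

  p n : ℕ
  p = suc q
  n = suc (suc (suc k)) * p

  ∣∁[U∪V]∣+[p+p]≡n+∣U∩V∣ : ∀ {U V : Subset n} → ∣ U ∣ ≡ p → ∣ V ∣ ≡ p →
                           ∣ ∁ (U ∪ V) ∣ + (p + p) ≡ n + ∣ U ∩ V ∣
  ∣∁[U∪V]∣+[p+p]≡n+∣U∩V∣ {U} {V} ∣U∣≡p ∣V∣≡p = begin
    ∣ ∁ (U ∪ V) ∣ + (p + p)
      ≡⟨ cong (∣ ∁ (U ∪ V) ∣ +_) (sym (trans (∣p∪q∣+∣p∩q∣≡∣p∣+∣q∣ U V) (cong₂ _+_ ∣U∣≡p ∣V∣≡p))) ⟩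
    ∣ ∁ (U ∪ V) ∣ + (∣ U ∪ V ∣ + ∣ U ∩ V ∣)
      ≡⟨ sym (+-assoc (∣ ∁ (U ∪ V) ∣) (∣ U ∪ V ∣) (∣ U ∩ V ∣)) ⟩
    ∣ ∁ (U ∪ V) ∣ + ∣ U ∪ V ∣ + ∣ U ∩ V ∣
      ≡⟨ cong (_+ ∣ U ∩ V ∣) (∣∁p∣+∣p∣≡n (U ∪ V)) ⟩
    n + ∣ U ∩ V ∣ ∎
    where open ≡-Reasoning

  p∣N-row : ∀ {U : Subset n} → ∣ U ∣ ≡ p → p ∣ sumOfSize n p (λ S → boolToℕ (N[ U ] S) * ∣ X ∩ S ∣)
  p∣N-row {U} ∣U∣≡p with [a*p+k]Ck≡1+t*p (suc k) p-prime (n<1+n q)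
  ... | t , C≡1+t*p = subst (p ∣_) (sym row≡) (p∣c*[1+t*p]+r (∣ X ∩ ∁ U ∣) t (∣ X ∩ U ∣) c+a≡p)
    where
    ∣∁U∣≡ : ∣ ∁ U ∣ ≡ suc (suc k * p + q)
    ∣∁U∣≡ = +-cancelʳ-≡ p _ _ (trans (trans (cong (∣ ∁ U ∣ +_) (sym ∣U∣≡p)) (∣∁p∣+∣p∣≡n U)) (arith k q))
      where
      arith : ∀ k q → suc (suc (suc k)) * suc q ≡ suc (suc k * suc q + q) + suc q
      arith = solve-∀
    row≡ : sumOfSize n p (λ S → boolToℕ (N[ U ] S) * ∣ X ∩ S ∣) ≡ ∣ X ∩ ∁ U ∣ * (1 + t * p) + ∣ X ∩ U ∣
    row≡ = trans (sumOfSize-N n X ∣U∣≡p)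
                 (cong (λ m → ∣ X ∩ ∁ U ∣ * m + ∣ X ∩ U ∣) (trans (cong (λ m → (m ∸ 1) C q) ∣∁U∣≡) C≡1+t*p))
    c+a≡p : ∣ X ∩ ∁ U ∣ + ∣ X ∩ U ∣ ≡ p
    c+a≡p = trans (+-comm (∣ X ∩ ∁ U ∣) (∣ X ∩ U ∣)) (trans (∣p∩q∣+∣p∩∁q∣≡∣p∣ X U) ∣X∣≡p)

  p∣disjoint-pair-row : ∀ {U V : Subset n} → ∣ U ∣ ≡ p → ∣ V ∣ ≡ p → U ≢ V → U ∩ V ≡ ⊥ →
                        p ∣ sumOfSize n p (λ S → boolToℕ (N[ U ] S ∧ N[ V ] S) * ∣ X ∩ S ∣)
  p∣disjoint-pair-row {U} {V} ∣U∣≡p ∣V∣≡p U≢V U∩V≡⊥ with [a*p+k]Ck≡1+t*p k p-prime (n<1+n q)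
  ... | t , C≡1+t*p = subst (p ∣_) (sym row≡) (p∣c*[1+t*p]+r c t (a + b) c+a+b≡p)
    where
    a b c : ℕ
    a = ∣ X ∩ U ∣
    b = ∣ X ∩ V ∣
    c = ∣ X ∩ ∁ (U ∪ V) ∣
    ∣∁[U∪V]∣≡ : ∣ ∁ (U ∪ V) ∣ ≡ suc (k * p + q)
    ∣∁[U∪V]∣≡ = +-cancelʳ-≡ (p + p) _ _ (begin
      ∣ ∁ (U ∪ V) ∣ + (p + p) ≡⟨ ∣∁[U∪V]∣+[p+p]≡n+∣U∩V∣ {U} {V} ∣U∣≡p ∣V∣≡p ⟩
      n + ∣ U ∩ V ∣           ≡⟨ cong (n +_) (trans (cong ∣_∣ U∩V≡⊥) (∣⊥∣≡0 n)) ⟩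
      n + 0                   ≡⟨ arith k q ⟩
      suc (k * p + q) + (p + p) ∎)
      where
      open ≡-Reasoning
      arith : ∀ k q → suc (suc (suc k)) * suc q + 0 ≡ suc (k * suc q + q) + (suc q + suc q)
      arith = solve-∀
    row≡ : sumOfSize n p (λ S → boolToℕ (N[ U ] S ∧ N[ V ] S) * ∣ X ∩ S ∣) ≡ c * (1 + t * p) + (a + b)
    row≡ = begin
      sumOfSize n p (λ S → boolToℕ (N[ U ] S ∧ N[ V ] S) * ∣ X ∩ S ∣)
        ≡⟨ sumOfSize-N∧N n X ∣U∣≡p ∣V∣≡p U≢V ⟩
      c * ((∣ ∁ (U ∪ V) ∣ ∸ 1) C q) + boolToℕ (does (U ∩ V ≟ˢ ⊥)) * (a + b)
        ≡⟨ cong₂ (λ m d → c * m + boolToℕ d * (a + b))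
                 (trans (cong (λ m → (m ∸ 1) C q) ∣∁[U∪V]∣≡) C≡1+t*p) (dec-true (U ∩ V ≟ˢ ⊥) U∩V≡⊥) ⟩
      c * (1 + t * p) + 1 * (a + b)
        ≡⟨ cong (c * (1 + t * p) +_) (*-identityˡ (a + b)) ⟩
      c * (1 + t * p) + (a + b) ∎
      where open ≡-Reasoning
    c+a+b≡p : c + (a + b) ≡ p
    c+a+b≡p = begin
      c + (a + b)               ≡⟨ cong (c +_) (sym (∣p∩[q∪r]∣≡∣p∩q∣+∣p∩r∣ X U V U∩V≡⊥)) ⟩
      c + ∣ X ∩ (U ∪ V) ∣       ≡⟨ +-comm c (∣ X ∩ (U ∪ V) ∣) ⟩
      ∣ X ∩ (U ∪ V) ∣ + c       ≡⟨ ∣p∩q∣+∣p∩∁q∣≡∣p∣ X (U ∪ V) ⟩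
      ∣ X ∣                     ≡⟨ ∣X∣≡p ⟩
      p                         ∎
      where open ≡-Reasoning

  p∣meeting-pair-row : ∀ {U V : Subset n} → ∣ U ∣ ≡ p → ∣ V ∣ ≡ p → U ≢ V → U ∩ V ≢ ⊥ →
                       p ∣ sumOfSize n p (λ S → boolToℕ (N[ U ] S ∧ N[ V ] S) * ∣ X ∩ S ∣)
  p∣meeting-pair-row {U} {V} ∣U∣≡p ∣V∣≡p U≢V U∩V≢⊥ with ∣ U ∩ V ∣ in ∣U∩V∣≡t | ∣p∩q∣≤∣p∣ U V
  ... | zero  | _       = ⊥-elim (U∩V≢⊥ (∣p∣≡0⇒p≡⊥ ∣U∩V∣≡t))
  ... | suc b | 1+b≤∣U∣ = subst (p ∣_) (sym row≡) (∣n⇒∣m*n (∣ X ∩ ∁ (U ∪ V) ∣) p∣C)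
    where
    1+b≢p : suc b ≢ p
    1+b≢p 1+b≡p = U≢V (∣p∩q∣≡∣p∣⇒∣p∩q∣≡∣q∣⇒p≡q U V (trans ∣U∩V∣≡p (sym ∣U∣≡p)) (trans ∣U∩V∣≡p (sym ∣V∣≡p)))
      where
      ∣U∩V∣≡p : ∣ U ∩ V ∣ ≡ p
      ∣U∩V∣≡p = trans ∣U∩V∣≡t 1+b≡p
    b<q : b < q
    b<q = s<s⁻¹ (≤∧≢⇒< (subst (suc b ≤_) ∣U∣≡p 1+b≤∣U∣) 1+b≢p)
    ∣∁[U∪V]∣≡ : ∣ ∁ (U ∪ V) ∣ ≡ suc (suc k * p + b)
    ∣∁[U∪V]∣≡ = +-cancelʳ-≡ (p + p) _ _
      (trans (∣∁[U∪V]∣+[p+p]≡n+∣U∩V∣ {U} {V} ∣U∣≡p ∣V∣≡p) (trans (cong (n +_) ∣U∩V∣≡t) (arith k q b)))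
      where
      arith : ∀ k q b → suc (suc (suc k)) * suc q + suc b ≡ suc (suc k * suc q + b) + (suc q + suc q)
      arith = solve-∀
    p∣C : p ∣ (∣ ∁ (U ∪ V) ∣ ∸ 1) C q
    p∣C = subst (λ m → p ∣ (m ∸ 1) C q) (sym ∣∁[U∪V]∣≡) (p∣[a*p+b]Ck (suc k) p-prime b<q (n<1+n q))
    row≡ : sumOfSize n p (λ S → boolToℕ (N[ U ] S ∧ N[ V ] S) * ∣ X ∩ S ∣) ≡
           ∣ X ∩ ∁ (U ∪ V) ∣ * ((∣ ∁ (U ∪ V) ∣ ∸ 1) C q)
    row≡ = trans (sumOfSize-N∧N n X ∣U∣≡p ∣V∣≡p U≢V)
      (trans (cong (λ d → ∣ X ∩ ∁ (U ∪ V) ∣ * ((∣ ∁ (U ∪ V) ∣ ∸ 1) C q) + boolToℕ d * (∣ X ∩ U ∣ + ∣ X ∩ V ∣))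
                   (dec-false (U ∩ V ≟ˢ ⊥) U∩V≢⊥))
             (+-identityʳ _))

  p∣row : ∀ (r : RARow n p) → p ∣ sumOfSize n p (λ S → boolToℕ (rowSet r S) * ∣ X ∩ S ∣)
  p∣row (inj₁ (U , ∣U∣≡p)) = p∣N-row {U} ∣U∣≡p
  p∣row (inj₂ ((U , ∣U∣≡p) , (V , ∣V∣≡p))) with U ≟ˢ V
  ... | yes refl =
    subst (p ∣_) (sumOfSize-cong n p (λ S → cong (λ b → boolToℕ b * ∣ X ∩ S ∣) (sym (∧-idem (N[ U ] S)))))
          (p∣N-row {U} ∣U∣≡p)
  ... | no U≢V with U ∩ V ≟ˢ ⊥
  ...   | yes U∩V≡⊥ = p∣disjoint-pair-row {U} {V} ∣U∣≡p ∣V∣≡p U≢V U∩V≡⊥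
  ...   | no U∩V≢⊥  = p∣meeting-pair-row {U} {V} ∣U∣≡p ∣V∣≡p U≢V U∩V≢⊥

mainTheorem2 : (p k : ℕ) → Prime p → k ≥ 3 →
    (x : KnVertex (k * p) p) → (r : RARow (k * p) p) →
    p ∣ RAApply (k * p) p (vecOf x) r
mainTheorem2 zero    _                          p-prime _                   _              _ =
  ⊥-elim (¬prime[0] p-prime)
mainTheorem2 (suc q) k@(suc (suc (suc k′))) p-prime (s≤s (s≤s (s≤s _))) x@(X , ∣X∣≡p) r =
  subst (suc q ∣_) (sym (RAApply≡sumOfSize (k * suc q) (suc q) x r)) (Kneser.p∣row q k′ p-prime X ∣X∣≡p r)
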